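{- Let $A$ be an associative, commutative, unital algebra, $\lambda$ a scalar, and $R:A\to A$ a Rota–Baxter operator of weight $\lambda$; put $\tilde R=-\lambda\,\mathrm{id}_A-R$. Let $\gamma\in A$ and let $\Theta:A\to\mathbb{C}$ be a unital algebra morphism with $\Theta(\gamma)=1$. Let $\mathcal I$, $a=-(\mathcal I-e)$, $F_{ -1}$, $G_{ -1}$ be as in the context, and set $\phi:=\Theta\circ F_{ -1}$ and $\psi:=\Theta\circ G_{ -1}^{\star-1}$ (where $G_{ -1}^{\star -1}$ is the convolution inverse of $G_{ -1}$). Then for every word $\underline\omega$ of length $n$, $$\phi(\underline\omega)=(-1)^{n}\,\Theta\big((Ra)^{[n]}(\underline\omega)\big)\qquad\text{and}\qquad \psi^{*-1}\circ\mathbf{rev}(\underline\omega)=\Theta\big(G_{ -1}(\mathbf{rev}(\underline\omega))\big)=(-1)^{n}\,\Theta\big((\tilde Ra)^{[n]}(\underline\omega)\big).$$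
   Context: Alphabet: $\Omega=\{1,2,3,\dots\}$ (positive integers, with their addition). A word is a finite sequence $\underline\omega=(\omega_1,\dots,\omega_n)$ of elements of $\Omega$; $\ell(\underline\omega)=n$ is its length, $\emptyset$ is the empty word. $\mathbf{Hqsh}$ denotes the quasi-shuffle Hopf algebra: the (graded completion of the) linear span of words, with product the quasi-shuffle defined recursively by $\emptyset$ being the unit and $(a\underline m)\ast(b\underline n)=a(\underline m\ast b\underline n)+b(a\underline m\ast\underline n)+(a+b)(\underline m\ast\underline n)$ for letters $a,b$ and words $\underline m,\underline n$ (juxtaposition = concatenation), and coproduct the deconcatenation $\Delta(\underline\omega)=\sum_{\underline\omega^1\underline\omega^2=\underline\omega}\underline\omega^1\otimes\underline\omega^2$. $\mathbf{rev}(\omega_1,\dots,\omega_n)=(\omega_n,\dots,\omega_1)$, extended linearly. For linear maps $f,g:\mathbf{Hqsh}\to A$ the convolution is $(f\star g)(\underline\omega)=\sum_{\underline\omega^1\underline\omega^2=\underline\omega}f(\underline\omega^1)g(\underline\omega^2)$, with unit $e$ given by $e(\emptyset)=1_A$ and $e(\underline\omega)=0$ for nonempty $\underline\omega$; the same convolution (denoted $*$) is used for linear forms $\mathbf{Hqsh}\to\mathbb{C}$, and $\psi^{*-1}$ is the convolution inverse. A linear operator $R$ on $A$ is a Rota–Baxter operator of weight $\lambda$ if $R(x)R(y)=R(R(x)y+xR(y)+\lambda xy)$ for all $x,y\in A$. Given $\gamma\in A$, $\mathcal I:\mathbf{Hqsh}\to A$ is the linear map with $\mathcal I(\emptyset)=1_A$,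 $\mathcal I((\omega))=\gamma^{\omega}$ for one-letter words, and $\mathcal I(\underline\omega)=0$ if $\ell(\underline\omega)\ge2$; $a:=-(\mathcal I-e)$. For a linear operator $P$ on $A$ define linear maps $\mathbf{Hqsh}\to A$ by $(Pa)^{[0]}=(Pa)^{\{0\}}=e$, $(Pa)^{[n+1]}=P\circ\big((Pa)^{[n]}\star a\big)$, $(Pa)^{\{n+1\}}=P\circ\big(a\star(Pa)^{\{n\}}\big)$. Let $F=\sum_{n\ge0}t^n(Ra)^{[n]}$ and $G=\sum_{n\ge0}t^n(\tilde Ra)^{\{n\}}$ (formal power series in $t$ with coefficients linear maps $\mathbf{Hqsh}\to A$), and let $F_{ -1},G_{ -1}$ be their evaluations at $t=-1$, i.e. $F_{ -1}(\underline\omega)=\sum_{n\ge0}(-1)^n(Ra)^{[n]}(\underline\omega)$ and $G_{ -1}(\underline\omega)=\sum_{n\ge0}(-1)^n(\tilde Ra)^{\{n\}}(\underline\omega)$ (for each word only finitely many terms are nonzero). -}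

module Defs where

open import Level using (Level; _⊔_)
import Level
open import Data.Nat using (ℕ; zero; suc)
open import Data.List using (List; []; _∷_; length)
open import Algebra.Bundles using (CommutativeRing)

-- Words over the alphabet Ω = {1,2,3,...}.  The letter ω ∈ Ω is encoded
-- by the natural number k with ω = suc k (a bijection ℕ ≃ Ω).
Letter : Set
Letter = ℕ

Word : Set
Word = List Letter

val : Letter → ℕ
val k = suc k

-- Generic constructions over a commutative ring S (target of linear maps
-- Hqsh → S; such a linear map is determined by its values on words).
module Over {c ℓ : Level} (S : CommutativeRing c ℓ) where
  open CommutativeRing S hiding (zero)

  pow : Carrier → ℕ → Carrier
  pow x zero    = 1#
  pow x (suc n) = x * pow x n

  sgn : ℕ → Carrier → Carrier
  sgn zero    x = x
  sgn (suc n) x = - sgn n x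

  -- convolution w.r.t. deconcatenation:
  -- (f ⋆ g)(w) = Σ_{w = u v} f(u) g(v)
  conv : (Word → Carrier) → (Word → Carrier) → Word → Carrier
  conv f g []      = f [] * g []
  conv f g (x ∷ w) = f [] * g (x ∷ w) + conv (λ u → f (x ∷ u)) g w

  unit : Word → Carrier
  unit []      = 1#
  unit (_ ∷ _) = 0#

-- A commutative unital algebra over the commutative ring K, given by a
-- commutative ring A together with a unital ring homomorphism ι : K → A
-- (the structure map; scalar multiplication is c · x = ι c * x).
record CommAlgebra {k ℓk : Level} (K : CommutativeRing k ℓk) (a ℓa : Level)
       : Set (k ⊔ ℓk ⊔ Level.suc (a ⊔ ℓa)) where
  field
    cring : CommutativeRing a ℓa
  open CommutativeRing cring hiding (zero)
  module K = CommutativeRing K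
  field
    ι      : K.Carrier → Carrier
    ι-cong : ∀ {c d} → c K.≈ d → ι c ≈ ι d
    ι-+    : ∀ c d → ι (c K.+ d) ≈ ι c + ι d
    ι-*    : ∀ c d → ι (c K.* d) ≈ ι c * ι d
    ι-1    : ι K.1# ≈ 1#

Car : ∀ {k ℓk a ℓa} {K : CommutativeRing k ℓk} → CommAlgebra K a ℓa → Set a
Car A = CommutativeRing.Carrier (CommAlgebra.cring A)

module Constructions {k ℓk a ℓa : Level} (K : CommutativeRing k ℓk)
       (A : CommAlgebra K a ℓa) (R : Car A → Car A)
       (λw : CommutativeRing.Carrier K) (γ : Car A) where
  open CommAlgebra A using (cring; ι)
  open CommutativeRing cring hiding (zero)
  open Over cring public

  R̃ : Carrier → Carrier
  R̃ x = - (ι λw * x) - R x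

  𝓘 : Word → Carrier
  𝓘 []          = 1#
  𝓘 (ω ∷ [])    = pow γ (val ω)
  𝓘 (_ ∷ _ ∷ _) = 0#

  𝒂 : Word → Carrier
  𝒂 w = - (𝓘 w - unit w)

  brk : (Carrier → Carrier) → ℕ → Word → Carrier
  brk P zero    = unit
  brk P (suc n) = λ w → P (conv (brk P n) 𝒂 w)

  brc : (Carrier → Carrier) → ℕ → Word → Carrier
  brc P zero    = unit
  brc P (suc n) = λ w → P (conv 𝒂 (brc P n) w)

  altSum : (ℕ → Carrier) → ℕ → Carrier
  altSum f zero    = f zero
  altSum f (suc m) = altSum f m + sgn (suc m) (f (suc m))

  -- F_{-1}(w) = Σ_n (-1)^n (Ra)^[n](w),  G_{-1}(w) = Σ_n (-1)^n (R̃a)^{n}(w);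
  -- terms with n > ℓ(w) vanish (each factor a kills the empty word), so
  -- the sums are truncated at n = ℓ(w).
  F₋₁ : Word → Carrier
  F₋₁ w = altSum (λ n → brk R n w) (length w)

  G₋₁ : Word → Carrier
  G₋₁ w = altSum (λ n → brc R̃ n w) (length w)

record IsRotaBaxter {k ℓk a ℓa : Level} (K : CommutativeRing k ℓk)
       (A : CommAlgebra K a ℓa) (λw : CommutativeRing.Carrier K)
       (R : Car A → Car A) : Set (k ⊔ a ⊔ ℓa) where
  open CommAlgebra A using (cring; ι)
  open CommutativeRing cring hiding (zero)
  field
    R-cong : ∀ {x y} → x ≈ y → R x ≈ R y
    R-+    : ∀ x y → R (x + y) ≈ R x + R y
    R-·    : ∀ c x → R (ι c * x) ≈ ι c * R x
    R-RB   : ∀ x y → R x * R y ≈ R (R x * y + x * R y + ι λw * (x * y))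

record IsAlgMorphism {k ℓk a ℓa : Level} (K : CommutativeRing k ℓk)
       (A : CommAlgebra K a ℓa) (Θ : Car A → CommutativeRing.Carrier K)
       : Set (k ⊔ ℓk ⊔ a ⊔ ℓa) where
  open CommAlgebra A using (cring; ι)
  open CommutativeRing cring hiding (zero)
  module K = CommutativeRing K
  field
    Θ-cong : ∀ {x y} → x ≈ y → Θ x K.≈ Θ y
    Θ-+    : ∀ x y → Θ (x + y) K.≈ Θ x K.+ Θ y
    Θ-*    : ∀ x y → Θ (x * y) K.≈ Θ x K.* Θ y
    Θ-1    : Θ 1# K.≈ K.1#
    Θ-ι    : ∀ c → Θ (ι c) K.≈ c

-- Every factor a kills all words except the one-letter ones, so (Ra)^[j] and (R̃a)^{j} vanish on
-- words of length ≠ j; the alternating series F₋₁ and G₋₁ therefore reduce to their top term.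
-- Since A is commutative, peeling letters off the left ((R̃a)^{j}) or off the right ((R̃a)^[j])
-- gives the same product up to reversing the word. Finally ψ^{⋆-1} and Θ ∘ G₋₁ are both convolution
-- inverses of Θ ∘ G₋₁^{⋆-1}, hence equal.
module Submission where

open import Defs
open import Level using (Level)
open import Data.Nat using (zero; suc; _≤_; z≤n; s≤s)
open import Data.Nat.Properties using (≤-refl; m≤n⇒m≤1+n; <⇒≢)
open import Data.List using ([]; _∷_; _∷ʳ_; length; reverse)
open import Data.List.Properties using (length-reverse; reverse-involutive; unfold-reverse)
open import Data.Product using (_×_; _,_)
open import Relation.Binary.PropositionalEquality as P using (_≢_)
open import Relation.Nullary using (contradiction)
open import Algebra.Bundles using (CommutativeRing)
import Algebra.Properties.Ring as RingProperties
import Relation.Binary.Reasoning.Setoid as SetoidReasoning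

module ConvolutionProperties {c ℓ} (S : CommutativeRing c ℓ) where
  open CommutativeRing S hiding (zero)
  open Over S
  open RingProperties ring using (-0#≈0#)
  open SetoidReasoning setoid

  conv-cong : ∀ {f f′ g g′} → (∀ u → f u ≈ f′ u) → (∀ u → g u ≈ g′ u) →
              ∀ w → conv f g w ≈ conv f′ g′ w
  conv-cong f≈ g≈ []      = *-cong (f≈ []) (g≈ [])
  conv-cong f≈ g≈ (x ∷ w) = +-cong (*-cong (f≈ []) (g≈ (x ∷ w))) (conv-cong (λ u → f≈ (x ∷ u)) g≈ w)

  conv-zeroˡ : ∀ {f} g → (∀ u → f u ≈ 0#) → ∀ w → conv f g w ≈ 0#
  conv-zeroˡ g f≈0 []      = trans (*-congʳ (f≈0 [])) (zeroˡ _)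
  conv-zeroˡ g f≈0 (x ∷ w) =
    trans (+-cong (trans (*-congʳ (f≈0 [])) (zeroˡ _)) (conv-zeroˡ g (λ u → f≈0 (x ∷ u)) w))
          (+-identityˡ 0#)

  conv-unitˡ : ∀ g w → conv unit g w ≈ g w
  conv-unitˡ g []      = *-identityˡ _
  conv-unitˡ g (x ∷ w) = trans (+-cong (*-identityˡ _) (conv-zeroˡ g (λ _ → refl) w)) (+-identityʳ _)

  conv-unitʳ : ∀ f w → conv f unit w ≈ f w
  conv-unitʳ f []      = *-identityʳ _
  conv-unitʳ f (x ∷ w) = trans (+-cong (zeroʳ _) (conv-unitʳ (λ u → f (x ∷ u)) w)) (+-identityˡ _)

  +-interchange : ∀ p q r s → (p + q) + (r + s) ≈ (p + r) + (q + s)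
  +-interchange p q r s = begin
    (p + q) + (r + s) ≈⟨ +-assoc p q (r + s) ⟩
    p + (q + (r + s)) ≈⟨ +-congˡ (sym (+-assoc q r s)) ⟩
    p + ((q + r) + s) ≈⟨ +-congˡ (+-congʳ (+-comm q r)) ⟩
    p + ((r + q) + s) ≈⟨ +-congˡ (+-assoc r q s) ⟩
    p + (r + (q + s)) ≈⟨ sym (+-assoc p r (q + s)) ⟩
    (p + r) + (q + s) ∎

  conv-distribʳ : ∀ f g h w → conv (λ u → f u + g u) h w ≈ conv f h w + conv g h w
  conv-distribʳ f g h []      = distribʳ _ _ _
  conv-distribʳ f g h (x ∷ w) =
    trans (+-cong (distribʳ _ _ _) (conv-distribʳ (λ u → f (x ∷ u)) (λ u → g (x ∷ u)) h w))
          (+-interchange _ _ _ _)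

  conv-scalarˡ : ∀ s f h w → conv (λ u → s * f u) h w ≈ s * conv f h w
  conv-scalarˡ s f h []      = *-assoc _ _ _
  conv-scalarˡ s f h (x ∷ w) =
    trans (+-cong (*-assoc _ _ _) (conv-scalarˡ s (λ u → f (x ∷ u)) h w)) (sym (distribˡ _ _ _))

  conv-assoc : ∀ f g h w → conv (conv f g) h w ≈ conv f (conv g h) w
  conv-assoc f g h []      = *-assoc _ _ _
  conv-assoc f g h (x ∷ w) = begin
    (f [] * g []) * h (x ∷ w) + conv (λ u → f [] * g (x ∷ u) + conv f′ g u) h w
      ≈⟨ +-congˡ (conv-distribʳ (λ u → f [] * g (x ∷ u)) (conv f′ g) h w) ⟩
    (f [] * g []) * h (x ∷ w) + (conv (λ u → f [] * g (x ∷ u)) h w + conv (conv f′ g) h w)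
      ≈⟨ +-congˡ (+-cong (conv-scalarˡ (f []) (λ u → g (x ∷ u)) h w) (conv-assoc f′ g h w)) ⟩
    (f [] * g []) * h (x ∷ w) + (f [] * conv (λ u → g (x ∷ u)) h w + conv f′ (conv g h) w)
      ≈⟨ sym (+-assoc _ _ _) ⟩
    ((f [] * g []) * h (x ∷ w) + f [] * conv (λ u → g (x ∷ u)) h w) + conv f′ (conv g h) w
      ≈⟨ +-congʳ (trans (+-congʳ (*-assoc _ _ _)) (sym (distribˡ _ _ _))) ⟩
    f [] * (g [] * h (x ∷ w) + conv (λ u → g (x ∷ u)) h w) + conv f′ (conv g h) w ∎
    where
    f′ : Word → Carrier
    f′ u = f (x ∷ u)

  conv-inverse-unique : ∀ {f g h} → (∀ w → conv h f w ≈ unit w) → (∀ w → conv f g w ≈ unit w) →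
                        ∀ w → h w ≈ g w
  conv-inverse-unique {f} {g} {h} h⋆f≈e f⋆g≈e w = begin
    h w                  ≈⟨ conv-unitʳ h w ⟨
    conv h unit w        ≈⟨ conv-cong (λ _ → refl) f⋆g≈e w ⟨
    conv h (conv f g) w  ≈⟨ conv-assoc h f g w ⟨
    conv (conv h f) g w  ≈⟨ conv-cong h⋆f≈e (λ _ → refl) w ⟩
    conv unit g w        ≈⟨ conv-unitˡ g w ⟩
    g w                  ∎

  sgn-cong : ∀ n {x y} → x ≈ y → sgn n x ≈ sgn n y
  sgn-cong zero    x≈y = x≈y
  sgn-cong (suc n) x≈y = -‿cong (sgn-cong n x≈y)

  sgn-0 : ∀ n → sgn n 0# ≈ 0#
  sgn-0 zero    = refl
  sgn-0 (suc n) = trans (-‿cong (sgn-0 n)) -0#≈0#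

  module OneLetterSupported {h : Word → Carrier}
         (h-[] : h [] ≈ 0#) (h-long : ∀ x y w → h (x ∷ y ∷ w) ≈ 0#) where

    conv-[]ˡ : ∀ g → conv h g [] ≈ 0#
    conv-[]ˡ g = trans (*-congʳ h-[]) (zeroˡ _)

    conv-[]ʳ : ∀ f → conv f h [] ≈ 0#
    conv-[]ʳ f = trans (*-congˡ h-[]) (zeroʳ _)

    conv-∷ˡ : ∀ g x w → conv h g (x ∷ w) ≈ h (x ∷ []) * g w
    conv-∷ˡ g x w = trans (+-cong (conv-[]ˡ (λ _ → g (x ∷ w))) (tail w)) (+-identityˡ _)
      where
      tail : ∀ w → conv (λ u → h (x ∷ u)) g w ≈ h (x ∷ []) * g w
      tail []      = refl
      tail (y ∷ w) = trans (+-congˡ (conv-zeroˡ g (h-long x y) w)) (+-identityʳ _)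

    conv-∷ʳ : ∀ f w x → conv f h (w ∷ʳ x) ≈ f w * h (x ∷ [])
    conv-∷ʳ f []      x = trans (+-congˡ (conv-[]ʳ (λ _ → f (x ∷ [])))) (+-identityʳ _)
    conv-∷ʳ f (y ∷ w) x =
      trans (+-cong (trans (*-congˡ (h-∷-∷ʳ w)) (zeroʳ _)) (conv-∷ʳ (λ u → f (y ∷ u)) w x))
            (+-identityˡ _)
      where
      h-∷-∷ʳ : ∀ w → h (y ∷ (w ∷ʳ x)) ≈ 0#
      h-∷-∷ʳ []      = h-long y x []
      h-∷-∷ʳ (z ∷ w) = h-long y z (w ∷ʳ x)

module AlgMorphismProperties {k ℓk a ℓa : Level} (K : CommutativeRing k ℓk) (A : CommAlgebra K a ℓa)
       {Θ : Car A → CommutativeRing.Carrier K} (isMorphism : IsAlgMorphism K A Θ) where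
  open IsAlgMorphism isMorphism
  private
    module AR = CommutativeRing (CommAlgebra.cring A)
    module AO = Over (CommAlgebra.cring A)
    module KO = Over K
    module KP = RingProperties K.ring

  Θ-0 : Θ AR.0# K.≈ K.0#
  Θ-0 = KP.x+x≈x⇒x≈0 _ (K.trans (K.sym (Θ-+ AR.0# AR.0#)) (Θ-cong (AR.+-identityˡ AR.0#)))

  Θ-neg : ∀ x → Θ (AR.- x) K.≈ K.- Θ x
  Θ-neg x = KP.+-inverseʳ-unique (Θ x) (Θ (AR.- x))
    (K.trans (K.sym (Θ-+ x (AR.- x))) (K.trans (Θ-cong (AR.-‿inverseʳ x)) Θ-0))

  Θ-sgn : ∀ n x → Θ (AO.sgn n x) K.≈ KO.sgn n (Θ x)
  Θ-sgn zero    x = K.refl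
  Θ-sgn (suc n) x = K.trans (Θ-neg _) (K.-‿cong (Θ-sgn n x))

  Θ-unit : ∀ w → Θ (AO.unit w) K.≈ KO.unit w
  Θ-unit []      = Θ-1
  Θ-unit (_ ∷ _) = Θ-0

  Θ-conv : ∀ f g w → Θ (AO.conv f g w) K.≈ KO.conv (λ u → Θ (f u)) (λ u → Θ (g u)) w
  Θ-conv f g []      = Θ-* _ _
  Θ-conv f g (x ∷ w) = K.trans (Θ-+ _ _) (K.+-cong (Θ-* _ _) (Θ-conv (λ u → f (x ∷ u)) g w))

module SeriesProperties {k ℓk a ℓa : Level} (K : CommutativeRing k ℓk) (A : CommAlgebra K a ℓa)
       (λw : CommutativeRing.Carrier K) (R : Car A → Car A) (γ : Car A) where
  open Constructions K A R λw γ
  open CommAlgebra A using (cring)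
  open CommutativeRing cring hiding (zero)
  open ConvolutionProperties cring
  open RingProperties ring using (-0#≈0#)

  𝒂-[] : 𝒂 [] ≈ 0#
  𝒂-[] = trans (-‿cong (-‿inverseʳ 1#)) -0#≈0#

  𝒂-long : ∀ x y w → 𝒂 (x ∷ y ∷ w) ≈ 0#
  𝒂-long _ _ _ = trans (-‿cong (-‿inverseʳ 0#)) -0#≈0#

  open OneLetterSupported {𝒂} 𝒂-[] 𝒂-long

  altSum-vanish : ∀ f m → (∀ n → n ≤ m → f n ≈ 0#) → altSum f m ≈ 0#
  altSum-vanish f zero    f≈0 = f≈0 zero z≤n
  altSum-vanish f (suc m) f≈0 =
    trans (+-cong (altSum-vanish f m (λ n n≤m → f≈0 n (m≤n⇒m≤1+n n≤m)))
                  (trans (sgn-cong (suc m) (f≈0 (suc m) ≤-refl)) (sgn-0 (suc m))))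
          (+-identityˡ 0#)

  altSum-concentrated : ∀ f N → (∀ n → n ≢ N → f n ≈ 0#) → altSum f N ≈ sgn N (f N)
  altSum-concentrated f zero    _   = refl
  altSum-concentrated f (suc m) f≈0 =
    trans (+-congʳ (altSum-vanish f m (λ n n≤m → f≈0 n (<⇒≢ (s≤s n≤m))))) (+-identityˡ _)

  module _ {Q : Carrier → Carrier} (Q-cong : ∀ {x y} → x ≈ y → Q x ≈ Q y) (Q-0 : Q 0# ≈ 0#) where

    brc-[] : ∀ j → brc Q (suc j) [] ≈ 0#
    brc-[] j = trans (Q-cong (conv-[]ˡ (brc Q j))) Q-0

    brc-∷ : ∀ j x w → brc Q (suc j) (x ∷ w) ≈ Q (𝒂 (x ∷ []) * brc Q j w)
    brc-∷ j x w = Q-cong (conv-∷ˡ (brc Q j) x w)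

    brc-vanish : ∀ j w → j ≢ length w → brc Q j w ≈ 0#
    brc-vanish zero    []      j≢ = contradiction P.refl j≢
    brc-vanish zero    (_ ∷ _) _  = refl
    brc-vanish (suc j) []      _  = brc-[] j
    brc-vanish (suc j) (x ∷ w) j≢ = begin
      brc Q (suc j) (x ∷ w)        ≈⟨ brc-∷ j x w ⟩
      Q (𝒂 (x ∷ []) * brc Q j w)  ≈⟨ Q-cong (*-congˡ (brc-vanish j w (λ j≡ → j≢ (P.cong suc j≡)))) ⟩
      Q (𝒂 (x ∷ []) * 0#)         ≈⟨ Q-cong (zeroʳ _) ⟩
      Q 0#                         ≈⟨ Q-0 ⟩
      0#                           ∎
      where open SetoidReasoning setoid

    brk-reverse : ∀ j v → brk Q j (reverse v) ≈ brc Q j v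
    brk-reverse zero    []      = refl
    brk-reverse zero    (x ∷ v) = P.subst (λ u → unit u ≈ 0#) (P.sym (unfold-reverse x v)) (unit-∷ʳ (reverse v))
      where
      unit-∷ʳ : ∀ u → unit (u ∷ʳ x) ≈ 0#
      unit-∷ʳ []      = refl
      unit-∷ʳ (_ ∷ _) = refl
    brk-reverse (suc j) []      = trans (trans (Q-cong (conv-[]ʳ (brk Q j))) Q-0) (sym (brc-[] j))
    brk-reverse (suc j) (x ∷ v) = begin
      brk Q (suc j) (reverse (x ∷ v))   ≡⟨ P.cong (brk Q (suc j)) (unfold-reverse x v) ⟩
      Q (conv (brk Q j) 𝒂 (reverse v ∷ʳ x)) ≈⟨ Q-cong (conv-∷ʳ (brk Q j) (reverse v) x) ⟩
      Q (brk Q j (reverse v) * 𝒂 (x ∷ [])) ≈⟨ Q-cong (*-congʳ (brk-reverse j v)) ⟩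
      Q (brc Q j v * 𝒂 (x ∷ []))           ≈⟨ Q-cong (*-comm _ _) ⟩
      Q (𝒂 (x ∷ []) * brc Q j v)           ≈⟨ brc-∷ j x v ⟨
      brc Q (suc j) (x ∷ v)                ∎
      where open SetoidReasoning setoid

    brc-reverse : ∀ j w → brc Q j (reverse w) ≈ brk Q j w
    brc-reverse j w = P.subst (λ u → brc Q j (reverse w) ≈ brk Q j u) (reverse-involutive w)
                            (sym (brk-reverse j (reverse w)))

    brk-vanish : ∀ j w → j ≢ length w → brk Q j w ≈ 0#
    brk-vanish j w j≢ = trans (sym (brc-reverse j w))
                              (brc-vanish j (reverse w) (P.subst (j ≢_) (P.sym (length-reverse w)) j≢))

  module _ (isRotaBaxter : IsRotaBaxter K A λw R) where
    open IsRotaBaxter isRotaBaxter using (R-cong; R-+)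
    open RingProperties ring using (x+x≈x⇒x≈0)

    R-0 : R 0# ≈ 0#
    R-0 = x+x≈x⇒x≈0 _ (trans (sym (R-+ 0# 0#)) (R-cong (+-identityˡ 0#)))

    R̃-cong : ∀ {x y} → x ≈ y → R̃ x ≈ R̃ y
    R̃-cong x≈y = +-cong (-‿cong (*-congˡ x≈y)) (-‿cong (R-cong x≈y))

    R̃-0 : R̃ 0# ≈ 0#
    R̃-0 = trans (+-cong (trans (-‿cong (zeroʳ _)) -0#≈0#) (trans (-‿cong R-0) -0#≈0#)) (+-identityˡ 0#)

    F₋₁-top : ∀ w → F₋₁ w ≈ sgn (length w) (brk R (length w) w)
    F₋₁-top w = altSum-concentrated (λ n → brk R n w) (length w) (λ n → brk-vanish R-cong R-0 n w)

    G₋₁-top : ∀ v → G₋₁ v ≈ sgn (length v) (brc R̃ (length v) v)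
    G₋₁-top v = altSum-concentrated (λ n → brc R̃ n v) (length v) (λ n → brc-vanish R̃-cong R̃-0 n v)

    G₋₁-reverse : ∀ w → G₋₁ (reverse w) ≈ sgn (length w) (brk R̃ (length w) w)
    G₋₁-reverse w = P.subst (λ n → G₋₁ (reverse w) ≈ sgn n (brk R̃ n w)) (length-reverse w)
      (trans (G₋₁-top (reverse w)) (sgn-cong (length (reverse w)) (brc-reverse R̃-cong R̃-0 (length (reverse w)) w)))

mainTheorem1 : ∀ {k ℓk a ℓa : Level} (K : CommutativeRing k ℓk) (A : CommAlgebra K a ℓa)
    (λw : CommutativeRing.Carrier K) (R : Car A → Car A) → IsRotaBaxter K A λw R →
    (γ : Car A) (Θ : Car A → CommutativeRing.Carrier K) → IsAlgMorphism K A Θ →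
    CommutativeRing._≈_ K (Θ γ) (CommutativeRing.1# K) →
    (Ginv : Word → Car A) →
    (∀ w → CommutativeRing._≈_ (CommAlgebra.cring A) (Over.conv (CommAlgebra.cring A) (Constructions.G₋₁ K A R λw γ) Ginv w) (Over.unit (CommAlgebra.cring A) w)) →
    (∀ w → CommutativeRing._≈_ (CommAlgebra.cring A) (Over.conv (CommAlgebra.cring A) Ginv (Constructions.G₋₁ K A R λw γ) w) (Over.unit (CommAlgebra.cring A) w)) →
    (ψinv : Word → CommutativeRing.Carrier K) →
    (∀ w → CommutativeRing._≈_ K (Over.conv K (λ u → Θ (Ginv u)) ψinv w) (Over.unit K w)) →
    (∀ w → CommutativeRing._≈_ K (Over.conv K ψinv (λ u → Θ (Ginv u)) w) (Over.unit K w)) →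
    ∀ (w : Word) →
      CommutativeRing._≈_ K (Θ (Constructions.F₋₁ K A R λw γ w))
        (Over.sgn K (length w) (Θ (Constructions.brk K A R λw γ R (length w) w)))
      × CommutativeRing._≈_ K (ψinv (reverse w)) (Θ (Constructions.G₋₁ K A R λw γ (reverse w)))
      × CommutativeRing._≈_ K (Θ (Constructions.G₋₁ K A R λw γ (reverse w)))
        (Over.sgn K (length w) (Θ (Constructions.brk K A R λw γ (Constructions.R̃ K A R λw γ) (length w) w)))
mainTheorem1 K A λw R isRotaBaxter γ Θ isMorphism _ Ginv _ Ginv⋆G≈e ψinv _ ψinv⋆ΘGinv≈e w =
  F₋₁-sign , ψinv≈ΘG₋₁ (reverse w) , G₋₁-sign
  where
  open Constructions K A R λw γ using (F₋₁; G₋₁; brk; R̃)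
  open SeriesProperties K A λw R γ using (F₋₁-top; G₋₁-reverse)
  open AlgMorphismProperties K A isMorphism
  open IsAlgMorphism isMorphism using (Θ-cong)
  module K = CommutativeRing K
  open ConvolutionProperties K using (conv-inverse-unique)

  F₋₁-sign : Θ (F₋₁ w) K.≈ Over.sgn K (length w) (Θ (brk R (length w) w))
  F₋₁-sign = K.trans (Θ-cong (F₋₁-top isRotaBaxter w)) (Θ-sgn (length w) _)

  G₋₁-sign : Θ (G₋₁ (reverse w)) K.≈ Over.sgn K (length w) (Θ (brk R̃ (length w) w))
  G₋₁-sign = K.trans (Θ-cong (G₋₁-reverse isRotaBaxter w)) (Θ-sgn (length w) _)

  ΘGinv⋆ΘG₋₁≈e : ∀ u → Over.conv K (λ v → Θ (Ginv v)) (λ v → Θ (G₋₁ v)) u K.≈ Over.unit K u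
  ΘGinv⋆ΘG₋₁≈e u = K.trans (K.sym (Θ-conv Ginv G₋₁ u)) (K.trans (Θ-cong (Ginv⋆G≈e u)) (Θ-unit u))

  ψinv≈ΘG₋₁ : ∀ u → ψinv u K.≈ Θ (G₋₁ u)
  ψinv≈ΘG₋₁ = conv-inverse-unique ψinv⋆ΘGinv≈e ΘGinv⋆ΘG₋₁≈e
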